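{- Fix an integer $q \geq 2$ and a threshold $\kappa > 0$. Given any positive integer $m$, there exists an integer $n_0 = \Theta(\sqrt{m})$ with $m/n_0^2 \leq \kappa$ such that the following holds for any $n \geq n_0$: in every $n$-vertex graph $G$ with $m$ edges which maximizes the number of proper $q$-colorings (among $n$-vertex graphs with $m$ edges), there is a set of $n_0$ vertices which spans all of the edges.
   Context: $n_0=\Theta(\sqrt m)$ means $c_1\sqrt m\le n_0\le c_2\sqrt m$ for constants $c_1,c_2>0$ depending only on $q$ and $\kappa$.
   Formalization: The threshold κ ranges over the positive rationals. -}

module Defs where

open import Data.Bool using (Bool; true; false; _∨_; _∧_; not)
open import Data.Nat using (ℕ; zero; suc; _<ᵇ_; _+_)
open import Data.Fin using (Fin; toℕ; _≟_)
open import Data.List using (List; []; _∷_; map; concatMap; allFin)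
open import Data.Bool.ListAction using (and)
open import Data.Integer using (+_)
open import Data.Rational using (ℚ; _/_)
open import Relation.Binary.PropositionalEquality using (_≡_)
open import Relation.Nullary.Decidable using (⌊_⌋)

record Graph (n : ℕ) : Set where
  field
    adj    : Fin n → Fin n → Bool
    sym    : ∀ i j → adj i j ≡ adj j i
    irrefl : ∀ i → adj i i ≡ false
open Graph public

countTrue : List Bool → ℕ
countTrue []           = 0
countTrue (true  ∷ bs) = suc (countTrue bs)
countTrue (false ∷ bs) = countTrue bs

edgeCount : ∀ {n} → Graph n → ℕ
edgeCount {n} G =
  countTrue (concatMap (λ i → map (λ j → (toℕ i <ᵇ toℕ j) ∧ adj G i j)
                                  (allFin n))
                       (allFin n))

extend : ∀ {n q} → Fin q → (Fin n → Fin q) → Fin (suc n) → Fin q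
extend a c Fin.zero    = a
extend a c (Fin.suc i) = c i

allColourings : (n q : ℕ) → List (Fin n → Fin q)
allColourings zero    q = (λ ()) ∷ []
allColourings (suc n) q =
  concatMap (λ c → map (λ a → extend a c) (allFin q)) (allColourings n q)

isProper : ∀ {n q} → Graph n → (Fin n → Fin q) → Bool
isProper {n} G c =
  and (concatMap (λ i → map (λ j → not (adj G i j) ∨ not ⌊ c i ≟ c j ⌋)
                            (allFin n))
                 (allFin n))

numColourings : ∀ {n} → ℕ → Graph n → ℕ
numColourings {n} q G = countTrue (map (isProper G) (allColourings n q))

ℕtoℚ : ℕ → ℚ
ℕtoℚ k = + k / 1

-- Take s with m ≤ s² ≤ 4m and n₀ = D·s, D = 4q²·↧κ. If at most n₀ vertices of G have a
-- neighbour, any n₀-set containing them spans all edges. Otherwise G has at least 2k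
-- non-isolated vertices, k = 2q²s, and deleting k times a vertex with a neighbour, chosen so
-- that at most two vertices become isolated each time, bounds the number P(G) of proper
-- colourings by P(G)·q^k ≤ q^n·(q−1)^k. The graph whose m edges fill part of the s × s grid
-- between the first s and the next s vertices has P ≥ q^(n−2s): giving the two sides two fixed
-- colours leaves every other vertex free. Since q^(2s)·(q−1)^k < q^k, that graph has more
-- colourings than G, against maximality.

module Submission where

open import Defs
open import Data.Bool as Bool using (Bool; true; false; _∧_; _∨_; not)
import Data.Bool.Properties as Bool
open import Data.Bool.ListAction using (and)
open import Data.Fin as Fin using (Fin; toℕ; punchIn; punchOut)
import Data.Fin.Properties as Fin
open import Data.Fin.Subset using (Subset; _∈_; ∣_∣; inside; outside; ⊤)
open import Data.Fin.Subset.Properties using (∣⊤∣≡n; ∈⊤)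
import Data.Integer as ℤ
import Data.Integer.Properties as ℤ
open import Data.List as List using (List; []; _∷_; map; concatMap; allFin; _++_)
import Data.List.Properties as List
open import Data.List.Relation.Unary.All using (All; []; _∷_)
import Data.List.Relation.Unary.All.Properties as All
open import Data.Nat as ℕ
  using (ℕ; zero; suc; _+_; _*_; _∸_; _^_; _≤_; _<_; z≤n; s≤s; _⊓_; _<ᵇ_; pred; NonZero)
import Data.Nat.Coprimality as Coprime
import Data.Nat.ListAction as ℕₗ
import Data.Nat.ListAction.Properties as ℕₗ
import Data.Nat.Properties as ℕ
open import Data.Nat.Tactic.RingSolver using (solve-∀)
open import Data.Product using (Σ; _×_; _,_; proj₁; proj₂; ∃)
open import Data.Rational using (ℚ; Positive; mkℚ; ↧ₙ_; *≤*) renaming (_≤_ to _≤ℚ_; _*_ to _*ℚ_)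
import Data.Rational.Properties as ℚ
import Data.Rational.Unnormalised as ℚᵘ
import Data.Rational.Unnormalised.Properties as ℚᵘ
open import Data.Sum using (_⊎_; inj₁; inj₂)
open import Data.Vec using ([]; _∷_; here; there)
open import Function using (_∘_; id; _⇔_; mk⇔; Equivalence)
open import Relation.Binary.PropositionalEquality as ≡
  using (_≡_; refl; trans; cong; cong₂; subst; subst₂; _≢_; module ≡-Reasoning)
open import Relation.Nullary using (¬_; Dec; does; yes; no; contradiction)
open import Relation.Nullary.Decidable
  using (⌊_⌋; dec-true; dec-false; does-⇔; ¬?; _×-dec_; _→-dec_; decidable-stable)

open import Algebra.Properties.Semiring.Sum ℕ.+-*-semiring
  using (sum-syntax; sum-cong-≗; sum-remove; ∑-comm; *-distribʳ-sum; *-distribˡ-sum)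

boolToℕ : Bool → ℕ
boolToℕ true  = 1
boolToℕ false = 0

true≢false : true ≢ false
true≢false ()

∨-true : ∀ x {y} → x ∨ y ≡ true → x ≡ true ⊎ y ≡ true
∨-true true  _ = inj₁ refl
∨-true false e = inj₂ e

boolToℕ≤1 : ∀ b → boolToℕ b ≤ 1
boolToℕ≤1 true  = ℕ.≤-refl
boolToℕ≤1 false = z≤n

∑-mono : ∀ {n} {f g : Fin n → ℕ} → (∀ i → f i ≤ g i) → ∑[ i < n ] f i ≤ ∑[ i < n ] g i
∑-mono {zero}  f≤g = z≤n
∑-mono {suc n} f≤g = ℕ.+-mono-≤ (f≤g Fin.zero) (∑-mono (f≤g ∘ Fin.suc))

term≤∑ : ∀ {n} (f : Fin n → ℕ) i → f i ≤ ∑[ j < n ] f j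
term≤∑ {suc n} f i = ℕ.≤-trans (ℕ.m≤m+n (f i) _) (ℕ.≤-reflexive (≡.sym (sum-remove f)))

∑-const : ∀ n k → ∑[ i < n ] k ≡ n * k
∑-const zero    k = refl
∑-const (suc n) k = cong (k +_) (∑-const n k)

∏ : ∀ {n} → (Fin n → ℕ) → ℕ
∏ {zero}  f = 1
∏ {suc n} f = f Fin.zero * ∏ (f ∘ Fin.suc)

∏-zero : ∀ {n} (f : Fin n → ℕ) i → f i ≡ 0 → ∏ f ≡ 0
∏-zero f Fin.zero    fi≡0 rewrite fi≡0 = refl
∏-zero f (Fin.suc i) fi≡0 rewrite ∏-zero (f ∘ Fin.suc) i fi≡0 = ℕ.*-zeroʳ (f Fin.zero)

∏-≤1 : ∀ {n} (f : Fin n → ℕ) → (∀ i → f i ≤ 1) → ∏ f ≤ 1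
∏-≤1 {zero}  f f≤1 = ℕ.≤-refl
∏-≤1 {suc n} f f≤1 = ℕ.*-mono-≤ (f≤1 Fin.zero) (∏-≤1 (f ∘ Fin.suc) (f≤1 ∘ Fin.suc))

count : ∀ {n} → (Fin n → Bool) → ℕ
count {n} b = ∑[ i < n ] boolToℕ (b i)

count≤n : ∀ {n} (b : Fin n → Bool) → count b ≤ n
count≤n {n} b = ℕ.≤-trans (∑-mono (boolToℕ≤1 ∘ b)) (ℕ.≤-reflexive (trans (∑-const n 1) (ℕ.*-identityʳ n)))

count-mono : ∀ {n} {b b′ : Fin n → Bool} → (∀ i → b i ≡ true → b′ i ≡ true) → count b ≤ count b′
count-mono {b = b} {b′} b⇒b′ = ∑-mono (λ i → mono (b i) (b′ i) (b⇒b′ i))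
  where
  mono : ∀ x y → (x ≡ true → y ≡ true) → boolToℕ x ≤ boolToℕ y
  mono false y       _   = z≤n
  mono true  y x⇒y rewrite x⇒y refl = ℕ.≤-refl

count-remove : ∀ {n} (b : Fin (suc n) → Bool) x → count b ≡ boolToℕ (b x) + count (b ∘ punchIn x)
count-remove b x = sum-remove (boolToℕ ∘ b)

count-false : ∀ {n} (b : Fin n → Bool) x → b x ≡ false → count b ≤ pred n
count-false {suc n} b x bx≡false = begin
  count b                                 ≡⟨ count-remove b x ⟩
  boolToℕ (b x) + count (b ∘ punchIn x)   ≡⟨ cong (λ y → boolToℕ y + count (b ∘ punchIn x)) bx≡false ⟩
  count (b ∘ punchIn x)                   ≤⟨ count≤n (b ∘ punchIn x) ⟩
  n                                       ∎
  where open ℕ.≤-Reasoning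

count-none : ∀ {n} (b : Fin n → Bool) → (∀ i → b i ≢ true) → count b ≡ 0
count-none {zero}  b _ = refl
count-none {suc n} b b≢true with b Fin.zero in eq
... | true  = contradiction eq (b≢true Fin.zero)
... | false = count-none (b ∘ Fin.suc) (b≢true ∘ Fin.suc)

count-some : ∀ {n} (b : Fin n → Bool) → 0 < count b → ∃ λ i → b i ≡ true
count-some {suc n} b 0<count with b Fin.zero in eq
... | true  = Fin.zero , eq
... | false = let i , bi = count-some (b ∘ Fin.suc) 0<count in Fin.suc i , bi

count-except : ∀ {n} {b b′ : Fin n → Bool} x →
  (∀ i → b i ≡ true → b′ i ≡ true ⊎ i ≡ x) → count b ≤ suc (count b′)
count-except {suc n} {b} {b′} x b⇒b′ = begin
  count b                                      ≡⟨ count-remove b x ⟩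
  boolToℕ (b x) + count (b ∘ punchIn x)        ≤⟨ ℕ.+-mono-≤ (boolToℕ≤1 (b x)) (count-mono away) ⟩
  suc (count (b′ ∘ punchIn x))                 ≤⟨ s≤s (ℕ.m≤n+m _ (boolToℕ (b′ x))) ⟩
  suc (boolToℕ (b′ x) + count (b′ ∘ punchIn x)) ≡⟨ cong suc (count-remove b′ x) ⟨
  suc (count b′)                               ∎
  where
  open ℕ.≤-Reasoning
  away : ∀ i → b (punchIn x i) ≡ true → b′ (punchIn x i) ≡ true
  away i bi with b⇒b′ (punchIn x i) bi
  ... | inj₁ b′i = b′i
  ... | inj₂ i≡x = contradiction i≡x (Fin.punchInᵢ≢i x i)

∑ᶜ : ∀ n q → ((Fin n → Fin q) → ℕ) → ℕ
∑ᶜ zero    q f = f (λ ())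
∑ᶜ (suc n) q f = ∑ᶜ n q (λ c → ∑[ a < q ] f (extend a c))

∑ᶜ-cong : ∀ n q {f g : (Fin n → Fin q) → ℕ} → (∀ c → f c ≡ g c) → ∑ᶜ n q f ≡ ∑ᶜ n q g
∑ᶜ-cong zero    q f≡g = f≡g _
∑ᶜ-cong (suc n) q f≡g = ∑ᶜ-cong n q (λ c → sum-cong-≗ (λ a → f≡g (extend a c)))

∑ᶜ-mono : ∀ n q {f g : (Fin n → Fin q) → ℕ} → (∀ c → f c ≤ g c) → ∑ᶜ n q f ≤ ∑ᶜ n q g
∑ᶜ-mono zero    q f≤g = f≤g _
∑ᶜ-mono (suc n) q f≤g = ∑ᶜ-mono n q (λ c → ∑-mono (λ a → f≤g (extend a c)))

∑ᶜ-*ˡ : ∀ n q k (f : (Fin n → Fin q) → ℕ) → ∑ᶜ n q (λ c → k * f c) ≡ k * ∑ᶜ n q f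
∑ᶜ-*ˡ zero    q k f = refl
∑ᶜ-*ˡ (suc n) q k f = trans (∑ᶜ-cong n q (λ c → ≡.sym (*-distribˡ-sum k (f ∘ (λ a → extend a c)))))
                           (∑ᶜ-*ˡ n q k (λ c → ∑[ a < q ] f (extend a c)))

∑ᶜ-const : ∀ n q k → ∑ᶜ n q (λ _ → k) ≡ q ^ n * k
∑ᶜ-const zero    q k = ≡.sym (ℕ.+-identityʳ k)
∑ᶜ-const (suc n) q k = begin
  ∑ᶜ n q (λ _ → ∑[ a < q ] k) ≡⟨ ∑ᶜ-cong n q (λ _ → ∑-const q k) ⟩
  ∑ᶜ n q (λ _ → q * k)        ≡⟨ ∑ᶜ-const n q (q * k) ⟩
  q ^ n * (q * k)             ≡⟨ reassoc (q ^ n) q k ⟩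
  q * q ^ n * k               ∎
  where
  open ≡-Reasoning
  reassoc : ∀ x y z → x * (y * z) ≡ y * x * z
  reassoc = solve-∀

∑ᶜ-∏ : ∀ n q (h : Fin n → Fin q → ℕ) →
  ∑ᶜ n q (λ c → ∏ (λ i → h i (c i))) ≡ ∏ (λ i → ∑[ a < q ] h i a)
∑ᶜ-∏ zero    q h = refl
∑ᶜ-∏ (suc n) q h = begin
  ∑ᶜ n q (λ c → ∑[ a < q ] (h Fin.zero a * ∏ (λ i → h (Fin.suc i) (c i))))
    ≡⟨ ∑ᶜ-cong n q (λ c → ≡.sym (*-distribʳ-sum (∏ (λ i → h (Fin.suc i) (c i))) (h Fin.zero))) ⟩
  ∑ᶜ n q (λ c → ∑[ a < q ] h Fin.zero a * ∏ (λ i → h (Fin.suc i) (c i)))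
    ≡⟨ ∑ᶜ-*ˡ n q (∑[ a < q ] h Fin.zero a) (λ c → ∏ (λ i → h (Fin.suc i) (c i))) ⟩
  ∑[ a < q ] h Fin.zero a * ∑ᶜ n q (λ c → ∏ (λ i → h (Fin.suc i) (c i)))
    ≡⟨ cong (∑[ a < q ] h Fin.zero a *_) (∑ᶜ-∏ n q (h ∘ Fin.suc)) ⟩
  ∑[ a < q ] h Fin.zero a * ∏ (λ i → ∑[ a < q ] h (Fin.suc i) a) ∎
  where open ≡-Reasoning

-- Unlike insertAt of Data.Vec.Functional this recurses on the position only, so that
-- insertAt (suc x) a (extend b c) reduces to extend b (insertAt x a c); no function
-- extensionality is available to identify the two.
insertAt : ∀ {n q} → Fin (suc n) → Fin q → (Fin n → Fin q) → Fin (suc n) → Fin q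
insertAt Fin.zero            a c = extend a c
insertAt {suc n} (Fin.suc x) a c = extend (c Fin.zero) (insertAt x a (c ∘ Fin.suc))

insertAt-here : ∀ {n q} x a (c : Fin n → Fin q) → insertAt x a c x ≡ a
insertAt-here Fin.zero            a c = refl
insertAt-here {suc n} (Fin.suc x) a c = insertAt-here x a (c ∘ Fin.suc)

insertAt-punchIn : ∀ {n q} x a (c : Fin n → Fin q) i → insertAt x a c (punchIn x i) ≡ c i
insertAt-punchIn Fin.zero            a c i           = refl
insertAt-punchIn {suc n} (Fin.suc x) a c Fin.zero    = refl
insertAt-punchIn {suc n} (Fin.suc x) a c (Fin.suc i) = insertAt-punchIn x a (c ∘ Fin.suc) i

∑ᶜ-insertAt : ∀ n q x (f : (Fin (suc n) → Fin q) → ℕ) →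
  ∑ᶜ (suc n) q f ≡ ∑ᶜ n q (λ c → ∑[ a < q ] f (insertAt x a c))
∑ᶜ-insertAt n       q Fin.zero    f = refl
∑ᶜ-insertAt (suc n) q (Fin.suc x) f = begin
  ∑ᶜ (suc n) q (λ d → ∑[ b < q ] f (extend b d))
    ≡⟨ ∑ᶜ-insertAt n q x (λ d → ∑[ b < q ] f (extend b d)) ⟩
  ∑ᶜ n q (λ c → ∑[ a < q ] ∑[ b < q ] f (extend b (insertAt x a c)))
    ≡⟨ ∑ᶜ-cong n q (λ c → ∑-comm (λ a b → f (extend b (insertAt x a c)))) ⟩
  ∑ᶜ n q (λ c → ∑[ b < q ] ∑[ a < q ] f (insertAt (Fin.suc x) a (extend b c))) ∎
  where open ≡-Reasoning

sum-map-tabulate : ∀ {A : Set} {n} (g : A → ℕ) (f : Fin n → A) →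
  ℕₗ.sum (map g (List.tabulate f)) ≡ ∑[ i < n ] g (f i)
sum-map-tabulate {n = zero}  g f = refl
sum-map-tabulate {n = suc n} g f = cong (g (f Fin.zero) +_) (sum-map-tabulate g (f ∘ Fin.suc))

sum-map-concatMap : ∀ {A B : Set} (g : B → ℕ) (f : A → List B) xs →
  ℕₗ.sum (map g (concatMap f xs)) ≡ ℕₗ.sum (map (λ x → ℕₗ.sum (map g (f x))) xs)
sum-map-concatMap g f []       = refl
sum-map-concatMap g f (x ∷ xs) = begin
  ℕₗ.sum (map g (f x ++ concatMap f xs))              ≡⟨ cong ℕₗ.sum (List.map-++ g (f x) _) ⟩
  ℕₗ.sum (map g (f x) ++ map g (concatMap f xs))      ≡⟨ ℕₗ.sum-++ (map g (f x)) _ ⟩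
  ℕₗ.sum (map g (f x)) + ℕₗ.sum (map g (concatMap f xs)) ≡⟨ cong (_ +_) (sum-map-concatMap g f xs) ⟩
  ℕₗ.sum (map g (f x)) + ℕₗ.sum (map (λ x → ℕₗ.sum (map g (f x))) xs) ∎
  where open ≡-Reasoning

countTrue≡sum : ∀ bs → countTrue bs ≡ ℕₗ.sum (map boolToℕ bs)
countTrue≡sum []           = refl
countTrue≡sum (true  ∷ bs) = cong suc (countTrue≡sum bs)
countTrue≡sum (false ∷ bs) = countTrue≡sum bs

sum-map-allColourings : ∀ n q (f : (Fin n → Fin q) → ℕ) → ℕₗ.sum (map f (allColourings n q)) ≡ ∑ᶜ n q f
sum-map-allColourings zero    q f = ℕ.+-identityʳ _
sum-map-allColourings (suc n) q f = begin
  ℕₗ.sum (map f (concatMap (λ c → map (λ a → extend a c) (allFin q)) (allColourings n q)))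
    ≡⟨ sum-map-concatMap f _ (allColourings n q) ⟩
  ℕₗ.sum (map (λ c → ℕₗ.sum (map f (map (λ a → extend a c) (allFin q)))) (allColourings n q))
    ≡⟨ cong ℕₗ.sum (List.map-cong (λ c → cong ℕₗ.sum (≡.sym (List.map-∘ {g = f} {f = λ a → extend a c} (allFin q)))) (allColourings n q)) ⟩
  ℕₗ.sum (map (λ c → ℕₗ.sum (map (λ a → f (extend a c)) (allFin q))) (allColourings n q))
    ≡⟨ cong ℕₗ.sum (List.map-cong (λ c → sum-map-tabulate (λ a → f (extend a c)) id) (allColourings n q)) ⟩
  ℕₗ.sum (map (λ c → ∑[ a < q ] f (extend a c)) (allColourings n q))
    ≡⟨ sum-map-allColourings n q _ ⟩
  ∑ᶜ n q (λ c → ∑[ a < q ] f (extend a c)) ∎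
  where open ≡-Reasoning

numColourings≡∑ᶜ : ∀ {n} q (G : Graph n) → numColourings q G ≡ ∑ᶜ n q (boolToℕ ∘ isProper G)
numColourings≡∑ᶜ {n} q G = begin
  countTrue (map (isProper G) (allColourings n q))
    ≡⟨ countTrue≡sum (map (isProper G) (allColourings n q)) ⟩
  ℕₗ.sum (map boolToℕ (map (isProper G) (allColourings n q)))
    ≡⟨ cong ℕₗ.sum (List.map-∘ {g = boolToℕ} {f = isProper G} (allColourings n q)) ⟨
  ℕₗ.sum (map (boolToℕ ∘ isProper G) (allColourings n q))
    ≡⟨ sum-map-allColourings n q (boolToℕ ∘ isProper G) ⟩
  ∑ᶜ n q (boolToℕ ∘ isProper G) ∎
  where open ≡-Reasoning

edgeCount≡∑ : ∀ {n} (G : Graph n) →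
  edgeCount G ≡ ∑[ i < n ] ∑[ j < n ] boolToℕ ((toℕ i <ᵇ toℕ j) ∧ adj G i j)
edgeCount≡∑ {n} G = begin
  countTrue (concatMap row (allFin n))                            ≡⟨ countTrue≡sum (concatMap row (allFin n)) ⟩
  ℕₗ.sum (map boolToℕ (concatMap row (allFin n)))                 ≡⟨ sum-map-concatMap boolToℕ row (allFin n) ⟩
  ℕₗ.sum (map (λ i → ℕₗ.sum (map boolToℕ (row i))) (allFin n))    ≡⟨ sum-map-tabulate (λ i → ℕₗ.sum (map boolToℕ (row i))) id ⟩
  ∑[ i < n ] ℕₗ.sum (map boolToℕ (row i))                         ≡⟨ sum-cong-≗ (λ i → cong ℕₗ.sum (List.map-∘ {g = boolToℕ} {f = entry i} (allFin n))) ⟨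
  ∑[ i < n ] ℕₗ.sum (map (λ j → boolToℕ (entry i j)) (allFin n))  ≡⟨ sum-cong-≗ (λ i → sum-map-tabulate (boolToℕ ∘ entry i) id) ⟩
  ∑[ i < n ] ∑[ j < n ] boolToℕ (entry i j)                       ∎
  where
  open ≡-Reasoning
  entry : Fin n → Fin n → Bool
  entry i j = (toℕ i <ᵇ toℕ j) ∧ adj G i j
  row : Fin n → List Bool
  row i = map (entry i) (allFin n)

and≡true⇔All : ∀ bs → and bs ≡ true ⇔ All (_≡ true) bs
and≡true⇔All []           = mk⇔ (λ _ → []) (λ _ → refl)
and≡true⇔All (false ∷ bs) = mk⇔ (λ ()) (λ { (() ∷ _) })
and≡true⇔All (true  ∷ bs) = mk⇔ (λ e → refl ∷ to e) (λ { (_ ∷ ps) → from ps })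
  where open Equivalence (and≡true⇔All bs)

and-map-allFin : ∀ {n} (p : Fin n → Bool) → and (map p (allFin n)) ≡ true ⇔ (∀ i → p i ≡ true)
and-map-allFin {n} p = mk⇔
  (All.tabulate⁻ ∘ All.map⁻ ∘ Equivalence.to (and≡true⇔All (map p (allFin n))))
  (Equivalence.from (and≡true⇔All (map p (allFin n))) ∘ All.map⁺ ∘ All.tabulate⁺)

and-concatMap-allFin : ∀ {n} (f : Fin n → List Bool) →
  and (concatMap f (allFin n)) ≡ true ⇔ (∀ i → and (f i) ≡ true)
and-concatMap-allFin {n} f = mk⇔
  (λ e i → Equivalence.from (and≡true⇔All (f i))
             (All.tabulate⁻ (All.map⁻ (All.concat⁻ (Equivalence.to (and≡true⇔All _) e))) i))
  (λ e → Equivalence.from (and≡true⇔All (concatMap f (allFin n)))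
           (All.concat⁺ (All.map⁺ (All.tabulate⁺ (λ i → Equivalence.to (and≡true⇔All (f i)) (e i))))))

Proper : ∀ {n q} → Graph n → (Fin n → Fin q) → Set
Proper G c = ∀ i j → adj G i j ≡ true → c i ≢ c j

properPair⇔ : ∀ {q} a (x y : Fin q) → (not a ∨ not ⌊ x Fin.≟ y ⌋ ≡ true) ⇔ (a ≡ true → x ≢ y)
properPair⇔ false x y = mk⇔ (λ _ ()) (λ _ → refl)
properPair⇔ true  x y with x Fin.≟ y
... | yes x≡y = mk⇔ (λ ()) (λ a⇒x≢y → contradiction x≡y (a⇒x≢y refl))
... | no  x≢y = mk⇔ (λ _ _ → x≢y) (λ _ → refl)

isProper⇔Proper : ∀ {n q} (G : Graph n) (c : Fin n → Fin q) → isProper G c ≡ true ⇔ Proper G c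
isProper⇔Proper {n} G c = mk⇔
  (λ e i j → to (pair i j) (to (and-map-allFin (entry i)) (to (and-concatMap-allFin row) e i) j))
  (λ p → from (and-concatMap-allFin row) (λ i → from (and-map-allFin (entry i)) (λ j → from (pair i j) (p i j))))
  where
  open Equivalence
  entry : Fin n → Fin n → Bool
  entry i j = not (adj G i j) ∨ not ⌊ c i Fin.≟ c j ⌋
  row : Fin n → List Bool
  row i = map (entry i) (allFin n)
  pair : ∀ i j → (entry i j ≡ true) ⇔ (adj G i j ≡ true → c i ≢ c j)
  pair i j = properPair⇔ (adj G i j) (c i) (c j)

-- Vertex deletion

removeVertex : ∀ {n} → Graph (suc n) → Fin (suc n) → Graph n
removeVertex G r = record
  { adj    = λ i j → adj G (punchIn r i) (punchIn r j)
  ; sym    = λ i j → Graph.sym G (punchIn r i) (punchIn r j)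
  ; irrefl = λ i → Graph.irrefl G (punchIn r i)
  }

adj⇒≢ : ∀ {n} (G : Graph n) {i j} → adj G i j ≡ true → i ≢ j
adj⇒≢ G {i} aij refl = true≢false (trans (≡.sym aij) (Graph.irrefl G i))

Proper-removeVertex : ∀ {n q} (G : Graph (suc n)) r a (c : Fin n → Fin q) →
  Proper G (insertAt r a c) → Proper (removeVertex G r) c
Proper-removeVertex G r a c proper i j aij ci≡cj =
  proper (punchIn r i) (punchIn r j) aij (begin
    insertAt r a c (punchIn r i) ≡⟨ insertAt-punchIn r a c i ⟩
    c i                          ≡⟨ ci≡cj ⟩
    c j                          ≡⟨ insertAt-punchIn r a c j ⟨
    insertAt r a c (punchIn r j) ∎)
  where open ≡-Reasoning

-- Once c is fixed on the other vertices, the colour of a neighbour j of r is forbidden at r.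
extensions-≤ : ∀ {n} q (G : Graph (suc n)) r j → adj G r j ≡ true → (c : Fin n → Fin q) →
  count (λ a → isProper G (insertAt r a c)) ≤ pred q * boolToℕ (isProper (removeVertex G r) c)
extensions-≤ q G r j arj c with isProper (removeVertex G r) c in eq
... | true  = ℕ.≤-trans (count-false _ (c j′) (Bool.¬-not clash)) (ℕ.≤-reflexive (≡.sym (ℕ.*-identityʳ (pred q))))
  where
  r≢j = adj⇒≢ G arj
  j′  = punchOut r≢j
  clash : isProper G (insertAt r (c j′) c) ≢ true
  clash e = Equivalence.to (isProper⇔Proper G _) e r j arj (begin
    insertAt r (c j′) c r              ≡⟨ insertAt-here r (c j′) c ⟩
    c j′                               ≡⟨ insertAt-punchIn r (c j′) c j′ ⟨
    insertAt r (c j′) c (punchIn r j′) ≡⟨ cong (insertAt r (c j′) c) (Fin.punchIn-punchOut r≢j) ⟩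
    insertAt r (c j′) c j              ∎)
    where open ≡-Reasoning
... | false = ℕ.≤-trans (ℕ.≤-reflexive (count-none _ improper)) z≤n
  where
  improper : ∀ a → isProper G (insertAt r a c) ≢ true
  improper a e = true≢false (trans (≡.sym (Equivalence.from (isProper⇔Proper (removeVertex G r) c)
    (Proper-removeVertex G r a c (Equivalence.to (isProper⇔Proper G _) e)))) eq)

numColourings-removeVertex : ∀ {n} q (G : Graph (suc n)) r j → adj G r j ≡ true →
  numColourings q G ≤ pred q * numColourings q (removeVertex G r)
numColourings-removeVertex {n} q G r j arj = begin
  numColourings q G                                                   ≡⟨ numColourings≡∑ᶜ q G ⟩
  ∑ᶜ (suc n) q (boolToℕ ∘ isProper G)                                 ≡⟨ ∑ᶜ-insertAt n q r (boolToℕ ∘ isProper G) ⟩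
  ∑ᶜ n q (λ c → count (λ a → isProper G (insertAt r a c)))            ≤⟨ ∑ᶜ-mono n q (extensions-≤ q G r j arj) ⟩
  ∑ᶜ n q (λ c → pred q * boolToℕ (isProper (removeVertex G r) c))     ≡⟨ ∑ᶜ-*ˡ n q (pred q) (boolToℕ ∘ isProper (removeVertex G r)) ⟩
  pred q * ∑ᶜ n q (boolToℕ ∘ isProper (removeVertex G r))             ≡⟨ cong (pred q *_) (numColourings≡∑ᶜ q (removeVertex G r)) ⟨
  pred q * numColourings q (removeVertex G r)                         ∎
  where open ℕ.≤-Reasoning

numColourings≤q^n : ∀ {n} q (G : Graph n) → numColourings q G ≤ q ^ n
numColourings≤q^n {n} q G = begin
  numColourings q G                   ≡⟨ numColourings≡∑ᶜ q G ⟩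
  ∑ᶜ n q (boolToℕ ∘ isProper G)       ≤⟨ ∑ᶜ-mono n q (boolToℕ≤1 ∘ isProper G) ⟩
  ∑ᶜ n q (λ _ → 1)                    ≡⟨ ∑ᶜ-const n q 1 ⟩
  q ^ n * 1                           ≡⟨ ℕ.*-identityʳ (q ^ n) ⟩
  q ^ n                               ∎
  where open ℕ.≤-Reasoning

hasNeighbour : ∀ {n} → Graph n → Fin n → Bool
hasNeighbour G i = ⌊ Fin.any? (λ j → adj G i j Bool.≟ true) ⌋

hasNeighbour⇔ : ∀ {n} (G : Graph n) i → hasNeighbour G i ≡ true ⇔ ∃ λ j → adj G i j ≡ true
hasNeighbour⇔ G i with Fin.any? (λ j → adj G i j Bool.≟ true)
... | yes p  = mk⇔ (λ _ → p) (λ _ → refl)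
... | no  ¬p = mk⇔ (λ ()) (λ p → contradiction p ¬p)

nonIsolated : ∀ {n} → Graph n → ℕ
nonIsolated G = count (hasNeighbour G)

Pendant : ∀ {n} → Graph n → Fin n → Fin n → Set
Pendant G y x = adj G y x ≡ true × (∀ w → adj G y w ≡ true → w ≡ x)

pendant? : ∀ {n} (G : Graph n) y x → Dec (Pendant G y x)
pendant? G y x = (adj G y x Bool.≟ true) ×-dec Fin.all? (λ w → (adj G y w Bool.≟ true) →-dec (w Fin.≟ x))

nonIsolated-or-pendant : ∀ {n} (G : Graph (suc n)) r i → hasNeighbour G (punchIn r i) ≡ true →
  hasNeighbour (removeVertex G r) i ≡ true ⊎ Pendant G (punchIn r i) r
nonIsolated-or-pendant G r i hz with Fin.any? (λ w → (adj G (punchIn r i) w Bool.≟ true) ×-dec ¬? (w Fin.≟ r))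
... | yes (w , azw , w≢r) = inj₁ (Equivalence.from (hasNeighbour⇔ (removeVertex G r) i)
        (punchOut r≢w , subst (λ v → adj G (punchIn r i) v ≡ true) (≡.sym (Fin.punchIn-punchOut r≢w)) azw))
  where r≢w = w≢r ∘ ≡.sym
... | no ¬other = inj₂ (subst (λ v → adj G (punchIn r i) v ≡ true) (onlyR w₀ azw₀) azw₀ , onlyR)
  where
  onlyR : ∀ w → adj G (punchIn r i) w ≡ true → w ≡ r
  onlyR w azw = decidable-stable (w Fin.≟ r) (λ w≢r → ¬other (w , azw , w≢r))
  w₀   = proj₁ (Equivalence.to (hasNeighbour⇔ G (punchIn r i)) hz)
  azw₀ = proj₂ (Equivalence.to (hasNeighbour⇔ G (punchIn r i)) hz)

-- Deleting r isolates, besides r itself, exactly the vertices pendant at r.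
nonIsolated-removeVertex : ∀ {n} (G : Graph (suc n)) r x → (∀ z → z ≢ x → ¬ Pendant G z r) →
  nonIsolated G ≤ 2 + nonIsolated (removeVertex G r)
nonIsolated-removeVertex G r x onlyAtX = begin
  nonIsolated G                                                     ≡⟨ count-remove (hasNeighbour G) r ⟩
  boolToℕ (hasNeighbour G r) + count (hasNeighbour G ∘ punchIn r)   ≤⟨ ℕ.+-mono-≤ (boolToℕ≤1 _) survivors ⟩
  2 + nonIsolated (removeVertex G r)                                ∎
  where
  open ℕ.≤-Reasoning
  survives : ∀ i → punchIn r i ≢ x → hasNeighbour G (punchIn r i) ≡ true →
             hasNeighbour (removeVertex G r) i ≡ true
  survives i z≢x hz with nonIsolated-or-pendant G r i hz
  ... | inj₁ h = h
  ... | inj₂ p = contradiction p (onlyAtX _ z≢x)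
  survivors : count (hasNeighbour G ∘ punchIn r) ≤ suc (nonIsolated (removeVertex G r))
  survivors with x Fin.≟ r
  ... | yes refl = ℕ.m≤n⇒m≤1+n (count-mono (λ i → survives i (Fin.punchInᵢ≢i r i)))
  ... | no  x≢r  = count-except x′ survivesExceptAtX
    where
    x′ = punchOut (x≢r ∘ ≡.sym)
    survivesExceptAtX : ∀ i → hasNeighbour G (punchIn r i) ≡ true →
                        hasNeighbour (removeVertex G r) i ≡ true ⊎ i ≡ x′
    survivesExceptAtX i hz with punchIn r i Fin.≟ x
    ... | yes z≡x = inj₂ (Fin.punchIn-injective r i x′ (trans z≡x (≡.sym (Fin.punchIn-punchOut _))))
    ... | no  z≢x = inj₁ (survives i z≢x hz)

removableVertex : ∀ {n} (G : Graph (suc n)) x → hasNeighbour G x ≡ true →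
  ∃ λ r → hasNeighbour G r ≡ true × nonIsolated G ≤ 2 + nonIsolated (removeVertex G r)
removableVertex G x hx with Fin.any? (λ y → pendant? G y x)
... | yes (y , ayx , onlyX) =
  y , Equivalence.from (hasNeighbour⇔ G y) (x , ayx) ,
  nonIsolated-removeVertex G y x (λ z z≢x (azy , _) → z≢x (onlyX z (trans (Graph.sym G y z) azy)))
... | no ¬pendant = x , hx , nonIsolated-removeVertex G x x (λ z _ p → ¬pendant (z , p))

numColourings-nonIsolated : ∀ q k {n} (G : Graph n) → 2 * k ≤ nonIsolated G →
  numColourings q G * q ^ k ≤ q ^ n * pred q ^ k
numColourings-nonIsolated q zero {n} G _ = ℕ.*-monoˡ-≤ 1 (numColourings≤q^n q G)
numColourings-nonIsolated q (suc k) {zero} G 2+2k≤0 with () ← ℕ.≤-trans 2+2k≤0 (count≤n (hasNeighbour G))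
numColourings-nonIsolated q (suc k) {suc n} G 2+2k≤ni
  with count-some (hasNeighbour G) (ℕ.≤-trans (s≤s z≤n) 2+2k≤ni)
... | x , hx with removableVertex G x hx
...   | r , hr , ni≤2+ni′ with Equivalence.to (hasNeighbour⇔ G r) hr
...     | j , arj = begin
  numColourings q G * (q * q ^ k)                            ≤⟨ ℕ.*-monoˡ-≤ _ (numColourings-removeVertex q G r j arj) ⟩
  pred q * numColourings q G′ * (q * q ^ k)                  ≡⟨ reassoc (pred q) _ q (q ^ k) ⟩
  pred q * q * (numColourings q G′ * q ^ k)                  ≤⟨ ℕ.*-monoʳ-≤ (pred q * q) (numColourings-nonIsolated q k G′ 2k≤ni′) ⟩
  pred q * q * (q ^ n * pred q ^ k)                          ≡⟨ reassoc′ (pred q) q (q ^ n) (pred q ^ k) ⟩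
  q * q ^ n * (pred q * pred q ^ k)                          ∎
  where
  open ℕ.≤-Reasoning
  G′ = removeVertex G r
  2k≤ni′ : 2 * k ≤ nonIsolated G′
  2k≤ni′ = ℕ.+-cancelˡ-≤ 2 _ _ (ℕ.≤-trans (ℕ.≤-reflexive (≡.sym (ℕ.*-suc 2 k))) (ℕ.≤-trans 2+2k≤ni ni≤2+ni′))
  reassoc : ∀ a b c d → a * b * (c * d) ≡ a * c * (b * d)
  reassoc = solve-∀
  reassoc′ : ∀ a b c d → a * b * (c * d) ≡ b * c * (a * d)
  reassoc′ = solve-∀

-- Bipartite graphs on the first s + s vertices

Straddles : ℕ → ℕ → ℕ → Set
Straddles s a b = a < s × s ≤ b × b < s + s

SplitBipartite : ∀ {n} → ℕ → Graph n → Set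
SplitBipartite s G = ∀ i j → adj G i j ≡ true → Straddles s (toℕ i) (toℕ j) ⊎ Straddles s (toℕ j) (toℕ i)

q^n≤q^K*∏ : ∀ q .{{_ : NonZero q}} n K (f : Fin n → ℕ) → (∀ i → 1 ≤ f i) → (∀ i → K ≤ toℕ i → f i ≡ q) →
  q ^ n ≤ q ^ K * ∏ f
q^n≤q^K*∏ q zero    K       f _   _     = ℕ.≤-trans (ℕ.m^n>0 q K) (ℕ.≤-reflexive (≡.sym (ℕ.*-identityʳ _)))
q^n≤q^K*∏ q (suc n) zero    f f≥1 f≡q = begin
  q * q ^ n                      ≤⟨ ℕ.*-monoʳ-≤ q (q^n≤q^K*∏ q n zero (f ∘ Fin.suc) (f≥1 ∘ Fin.suc) (λ i _ → f≡q (Fin.suc i) z≤n)) ⟩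
  q * (1 * ∏ (f ∘ Fin.suc))          ≡⟨ cong (λ y → y * (1 * ∏ (f ∘ Fin.suc))) (f≡q Fin.zero z≤n) ⟨
  f Fin.zero * (1 * ∏ (f ∘ Fin.suc)) ≡⟨ reassoc (f Fin.zero) (∏ (f ∘ Fin.suc)) ⟩
  1 * (f Fin.zero * ∏ (f ∘ Fin.suc)) ∎
  where
  open ℕ.≤-Reasoning
  reassoc : ∀ a b → a * (1 * b) ≡ 1 * (a * b)
  reassoc = solve-∀
q^n≤q^K*∏ q (suc n) (suc K) f f≥1 f≡q = begin
  q * q ^ n                                  ≤⟨ ℕ.*-monoʳ-≤ q (q^n≤q^K*∏ q n K (f ∘ Fin.suc) (f≥1 ∘ Fin.suc) (λ i K≤i → f≡q (Fin.suc i) (s≤s K≤i))) ⟩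
  q * (q ^ K * ∏ (f ∘ Fin.suc))              ≤⟨ ℕ.m≤n*m _ (f Fin.zero) {{ℕ.>-nonZero (f≥1 Fin.zero)}} ⟩
  f Fin.zero * (q * (q ^ K * ∏ (f ∘ Fin.suc))) ≡⟨ reassoc (f Fin.zero) q (q ^ K) (∏ (f ∘ Fin.suc)) ⟩
  q * q ^ K * (f Fin.zero * ∏ (f ∘ Fin.suc)) ∎
  where
  open ℕ.≤-Reasoning
  reassoc : ∀ a b c d → a * (b * (c * d)) ≡ b * c * (a * d)
  reassoc = solve-∀

module _ {q} (a b : Fin q) (s : ℕ) where

  template : ∀ {n} → Fin n → Fin q
  template i with toℕ i ℕ.<? s
  ... | yes _ = a
  ... | no  _ = b

  template-< : ∀ {n} (i : Fin n) → toℕ i < s → template i ≡ a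
  template-< i i<s with toℕ i ℕ.<? s
  ... | yes _   = refl
  ... | no  i≮s = contradiction i<s i≮s

  template-≥ : ∀ {n} (i : Fin n) → s ≤ toℕ i → template i ≡ b
  template-≥ i s≤i with toℕ i ℕ.<? s
  ... | yes i<s = contradiction s≤i (ℕ.<⇒≱ i<s)
  ... | no  _   = refl

  -- The colourings of positive weight are those agreeing with the template on the first s + s vertices.
  weight : ∀ {n} → Fin n → Fin q → ℕ
  weight i x with toℕ i ℕ.<? s + s
  ... | yes _ = boolToℕ (does (x Fin.≟ template i))
  ... | no  _ = 1

  weight≤1 : ∀ {n} (i : Fin n) x → weight i x ≤ 1
  weight≤1 i x with toℕ i ℕ.<? s + s
  ... | yes _ = boolToℕ≤1 _
  ... | no  _ = ℕ.≤-refl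

  weight≢0 : ∀ {n} (i : Fin n) x → weight i x ≢ 0 → toℕ i < s + s → x ≡ template i
  weight≢0 i x w≢0 i<2s with toℕ i ℕ.<? s + s
  ... | no  i≮2s = contradiction i<2s i≮2s
  ... | yes _ with x Fin.≟ template i
  ...   | yes x≡t = x≡t
  ...   | no  _   = contradiction refl w≢0

  ∑weight≥1 : ∀ {n} (i : Fin n) → 1 ≤ ∑[ x < q ] weight i x
  ∑weight≥1 i with toℕ i ℕ.<? s + s
  ... | yes _ = begin
    1                                          ≡⟨ cong boolToℕ (dec-true (template i Fin.≟ template i) refl) ⟨
    boolToℕ (does (template i Fin.≟ template i))    ≤⟨ term≤∑ (λ x → boolToℕ (does (x Fin.≟ template i))) (template i) ⟩
    ∑[ x < q ] boolToℕ (does (x Fin.≟ template i))  ∎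
    where open ℕ.≤-Reasoning
  ... | no _ = term≤∑ (λ _ → 1) a

  ∑weight≡q : ∀ {n} (i : Fin n) → s + s ≤ toℕ i → ∑[ x < q ] weight i x ≡ q
  ∑weight≡q i 2s≤i with toℕ i ℕ.<? s + s
  ... | yes i<2s = contradiction 2s≤i (ℕ.<⇒≱ i<2s)
  ... | no  _    = trans (∑-const q 1) (ℕ.*-identityʳ q)

  straddle-colours : ∀ {n} (c : Fin n → Fin q) → ∏ (λ i → weight i (c i)) ≢ 0 →
    ∀ {i j} → Straddles s (toℕ i) (toℕ j) → c i ≡ a × c j ≡ b
  straddle-colours c ∏≢0 {i} {j} (i<s , s≤j , j<2s) =
    trans (agrees i (ℕ.<-≤-trans i<s (ℕ.m≤m+n s s))) (template-< i i<s) ,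
    trans (agrees j j<2s) (template-≥ j s≤j)
    where
    agrees : ∀ i → toℕ i < s + s → c i ≡ template i
    agrees i = weight≢0 i (c i) (λ w≡0 → ∏≢0 (∏-zero _ i w≡0))

  weighted⇒Proper : a ≢ b → ∀ {n} (G : Graph n) → SplitBipartite s G → (c : Fin n → Fin q) →
    ∏ (λ i → weight i (c i)) ≢ 0 → Proper G c
  weighted⇒Proper a≢b G split c ∏≢0 i j aij ci≡cj with split i j aij
  ... | inj₁ ij = let ci≡a , cj≡b = straddle-colours c ∏≢0 ij in a≢b (trans (≡.sym ci≡a) (trans ci≡cj cj≡b))
  ... | inj₂ ji = let cj≡a , ci≡b = straddle-colours c ∏≢0 ji in a≢b (trans (≡.sym cj≡a) (trans (≡.sym ci≡cj) ci≡b))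

  weighted≤proper : a ≢ b → ∀ {n} (G : Graph n) → SplitBipartite s G → (c : Fin n → Fin q) →
    ∏ (λ i → weight i (c i)) ≤ boolToℕ (isProper G c)
  weighted≤proper a≢b G split c with ∏ (λ i → weight i (c i)) ℕ.≟ 0
  ... | yes ∏≡0 = ℕ.≤-trans (ℕ.≤-reflexive ∏≡0) z≤n
  ... | no  ∏≢0 rewrite Equivalence.from (isProper⇔Proper G c) (weighted⇒Proper a≢b G split c ∏≢0) =
    ∏-≤1 _ (λ i → weight≤1 i (c i))

  numColourings-splitBipartite : a ≢ b → ∀ {n} (G : Graph n) → SplitBipartite s G →
    q ^ n ≤ q ^ (s + s) * numColourings q G
  numColourings-splitBipartite a≢b {n} G split = begin
    q ^ n                                                           ≤⟨ q^n≤q^K*∏ q {{q≢0}} n (s + s) (λ i → ∑[ x < q ] weight i x) (∑weight≥1 {n}) (∑weight≡q {n}) ⟩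
    q ^ (s + s) * ∏ (λ (i : Fin n) → ∑[ x < q ] weight i x)         ≡⟨ cong (q ^ (s + s) *_) (∑ᶜ-∏ n q (λ i → weight {n} i)) ⟨
    q ^ (s + s) * ∑ᶜ n q (λ c → ∏ (λ i → weight i (c i)))           ≤⟨ ℕ.*-monoʳ-≤ (q ^ (s + s)) (∑ᶜ-mono n q (weighted≤proper a≢b G split)) ⟩
    q ^ (s + s) * ∑ᶜ n q (boolToℕ ∘ isProper G)                     ≡⟨ cong (q ^ (s + s) *_) (numColourings≡∑ᶜ q G) ⟨
    q ^ (s + s) * numColourings q G                                 ∎
    where
    open ℕ.≤-Reasoning
    q≢0 : NonZero q
    q≢0 = ℕ.>-nonZero (ℕ.≤-trans (s≤s z≤n) (Fin.toℕ<n a))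

sumBelow : ℕ → (ℕ → ℕ) → ℕ
sumBelow zero    g = 0
sumBelow (suc n) g = g 0 + sumBelow n (g ∘ suc)

∑-toℕ : ∀ n (g : ℕ → ℕ) → ∑[ i < n ] g (toℕ i) ≡ sumBelow n g
∑-toℕ zero    g = refl
∑-toℕ (suc n) g = cong (g 0 +_) (∑-toℕ n (g ∘ suc))

sumBelow-cong : ∀ n {g h : ℕ → ℕ} → (∀ b → b < n → g b ≡ h b) → sumBelow n g ≡ sumBelow n h
sumBelow-cong zero    g≡h = refl
sumBelow-cong (suc n) g≡h = cong₂ _+_ (g≡h 0 (s≤s z≤n)) (sumBelow-cong n (λ b b<n → g≡h (suc b) (s≤s b<n)))

sumBelow-zero : ∀ n {g : ℕ → ℕ} → (∀ b → b < n → g b ≡ 0) → sumBelow n g ≡ 0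
sumBelow-zero zero    g≡0 = refl
sumBelow-zero (suc n) g≡0 = cong₂ _+_ (g≡0 0 (s≤s z≤n)) (sumBelow-zero n (λ b b<n → g≡0 (suc b) (s≤s b<n)))

sumBelow-+ : ∀ k l (g : ℕ → ℕ) → sumBelow (k + l) g ≡ sumBelow k g + sumBelow l (λ b → g (k + b))
sumBelow-+ zero    l g = refl
sumBelow-+ (suc k) l g = trans (cong (g 0 +_) (sumBelow-+ k l (g ∘ suc))) (≡.sym (ℕ.+-assoc (g 0) _ _))

sumBelow-< : ∀ n K → sumBelow n (λ b → boolToℕ (does (b ℕ.<? K))) ≡ n ⊓ K
sumBelow-< zero    K       = refl
sumBelow-< (suc n) zero    = sumBelow-zero n (λ _ _ → refl)
sumBelow-< (suc n) (suc K) = cong suc (sumBelow-< n K)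

+<⇔<∸ : ∀ x y m → x + y < m ⇔ y < m ∸ x
+<⇔<∸ x y m = mk⇔
  (λ x+y<m → ℕ.m+n≤o⇒m≤o∸n (suc y) (subst (_≤ m) (cong suc (ℕ.+-comm x y)) x+y<m))
  (λ y<m∸x → subst (_≤ m) (cong suc (ℕ.+-comm y x)) (ℕ.m≤o∸n⇒m+n≤o (suc y) (x≤m y<m∸x) y<m∸x))
  where
  x≤m : y < m ∸ x → x ≤ m
  x≤m y<m∸x = ℕ.<⇒≤ (ℕ.m∸n≢0⇒n<m (λ m∸x≡0 → contradiction (subst (y <_) m∸x≡0 y<m∸x) (λ ())))

-- (a, b ∸ s) is one of the first m cells of the s × s grid in row-major order.
GridEdge : ℕ → ℕ → ℕ → ℕ → Set
GridEdge s m a b = a < s × s ≤ b × b ∸ s < s × a * s + (b ∸ s) < m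

gridEdge? : ∀ s m a b → Dec (GridEdge s m a b)
gridEdge? s m a b = (a ℕ.<? s) ×-dec (s ℕ.≤? b) ×-dec (b ∸ s ℕ.<? s) ×-dec (a * s + (b ∸ s) ℕ.<? m)

GridEdge⇒< : ∀ {s m a b} → GridEdge s m a b → a < b
GridEdge⇒< (a<s , s≤b , _) = ℕ.<-≤-trans a<s s≤b

does⇒ : ∀ {A : Set} (a? : Dec A) → does a? ≡ true → A
does⇒ (yes a) _ = a

gridGraph : ℕ → ℕ → ∀ n → Graph n
gridGraph s m n = record
  { adj    = λ i j → does (gridEdge? s m (toℕ i) (toℕ j)) ∨ does (gridEdge? s m (toℕ j) (toℕ i))
  ; sym    = λ i j → Bool.∨-comm (does (gridEdge? s m (toℕ i) (toℕ j))) _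
  ; irrefl = λ i → cong (λ e → e ∨ e) (dec-false (gridEdge? s m (toℕ i) (toℕ i)) (ℕ.<-irrefl refl ∘ GridEdge⇒<))
  }

GridEdge⇒Straddles : ∀ {s m a b} → GridEdge s m a b → Straddles s a b
GridEdge⇒Straddles {s} (a<s , s≤b , b∸s<s , _) =
  a<s , s≤b , subst (_< s + s) (ℕ.m+[n∸m]≡n s≤b) (ℕ.+-monoʳ-< s b∸s<s)

gridGraph-splitBipartite : ∀ s m n → SplitBipartite s (gridGraph s m n)
gridGraph-splitBipartite s m n i j aij with ∨-true (does (gridEdge? s m (toℕ i) (toℕ j))) aij
... | inj₁ eij = inj₁ (GridEdge⇒Straddles (does⇒ (gridEdge? s m _ _) eij))
... | inj₂ eji = inj₂ (GridEdge⇒Straddles (does⇒ (gridEdge? s m _ _) eji))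

∧-∨-select : ∀ x y z → (y ≡ true → x ≡ true) → (z ≡ true → x ≡ false) → x ∧ (y ∨ z) ≡ y
∧-∨-select x true  z y⇒x _   rewrite y⇒x refl = refl
∧-∨-select x false true _ z⇒¬x rewrite z⇒¬x refl = refl
∧-∨-select x false false _ _ = Bool.∧-zeroʳ x

ordered-gridEdge : ∀ s m a b →
  does (a ℕ.<? b) ∧ (does (gridEdge? s m a b) ∨ does (gridEdge? s m b a)) ≡ does (gridEdge? s m a b)
ordered-gridEdge s m a b = ∧-∨-select _ _ _
  (λ eab → dec-true (a ℕ.<? b) (GridEdge⇒< (does⇒ (gridEdge? s m a b) eab)))
  (λ eba → dec-false (a ℕ.<? b) (ℕ.<⇒≯ (GridEdge⇒< (does⇒ (gridEdge? s m b a) eba))))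

gridEdge-shift⇔ : ∀ s m a b′ → a < s → GridEdge s m a (s + b′) ⇔ b′ < s ⊓ (m ∸ a * s)
gridEdge-shift⇔ s m a b′ a<s = mk⇔
  (λ { (_ , _ , b′<s , cell<m) →
       ℕ.⊓-pres-m< (subst (_< s) shift b′<s)
                   (Equivalence.to (+<⇔<∸ (a * s) b′ m) (subst (λ y → a * s + y < m) shift cell<m)) })
  (λ b′<⊓ → a<s , ℕ.m≤m+n s b′ , subst (_< s) (≡.sym shift) (ℕ.m<n⊓o⇒m<n s _ b′<⊓) ,
            subst (λ y → a * s + y < m) (≡.sym shift)
                  (Equivalence.from (+<⇔<∸ (a * s) b′ m) (ℕ.m<n⊓o⇒m<o s _ b′<⊓)))
  where
  shift : s + b′ ∸ s ≡ b′
  shift = ℕ.m+n∸m≡n s b′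

gridRow : ∀ s m n′ a → s ≤ n′ → a < s →
  sumBelow (s + n′) (λ b → boolToℕ (does (gridEdge? s m a b))) ≡ s ⊓ (m ∸ a * s)
gridRow s m n′ a s≤n′ a<s = begin
  sumBelow (s + n′) (λ b → boolToℕ (does (gridEdge? s m a b)))
    ≡⟨ sumBelow-+ s n′ _ ⟩
  sumBelow s (λ b → boolToℕ (does (gridEdge? s m a b))) + sumBelow n′ (λ b′ → boolToℕ (does (gridEdge? s m a (s + b′))))
    ≡⟨ cong₂ _+_ (sumBelow-zero s (λ b b<s → cong boolToℕ (dec-false (gridEdge? s m a b) (ℕ.<⇒≱ b<s ∘ proj₁ ∘ proj₂))))
                 (sumBelow-cong n′ (λ b′ _ → cong boolToℕ (does-⇔ (gridEdge-shift⇔ s m a b′ a<s) (gridEdge? s m a (s + b′)) (b′ ℕ.<? s ⊓ (m ∸ a * s))))) ⟩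
  sumBelow n′ (λ b′ → boolToℕ (does (b′ ℕ.<? s ⊓ (m ∸ a * s))))
    ≡⟨ sumBelow-< n′ (s ⊓ (m ∸ a * s)) ⟩
  n′ ⊓ (s ⊓ (m ∸ a * s))
    ≡⟨ ℕ.m≥n⇒m⊓n≡n (ℕ.≤-trans (ℕ.m⊓n≤m s _) s≤n′) ⟩
  s ⊓ (m ∸ a * s) ∎
  where open ≡-Reasoning

⊓-telescope-step : ∀ s m x → s ⊓ m + x ⊓ (m ∸ s) ≡ (s + x) ⊓ m
⊓-telescope-step s m x with ℕ.≤-total m s
... | inj₁ m≤s = begin
  s ⊓ m + x ⊓ (m ∸ s) ≡⟨ cong₂ _+_ (ℕ.m≥n⇒m⊓n≡n m≤s) (cong (x ⊓_) (ℕ.m≤n⇒m∸n≡0 m≤s)) ⟩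
  m + x ⊓ 0           ≡⟨ cong (m +_) (ℕ.⊓-zeroʳ x) ⟩
  m + 0               ≡⟨ ℕ.+-identityʳ m ⟩
  m                   ≡⟨ ℕ.m≥n⇒m⊓n≡n (ℕ.≤-trans m≤s (ℕ.m≤m+n s x)) ⟨
  (s + x) ⊓ m         ∎
  where open ≡-Reasoning
... | inj₂ s≤m = begin
  s ⊓ m + x ⊓ (m ∸ s)         ≡⟨ cong (_+ x ⊓ (m ∸ s)) (ℕ.m≤n⇒m⊓n≡m s≤m) ⟩
  s + x ⊓ (m ∸ s)             ≡⟨ ℕ.+-distribˡ-⊓ s x (m ∸ s) ⟩
  (s + x) ⊓ (s + (m ∸ s))     ≡⟨ cong ((s + x) ⊓_) (ℕ.m+[n∸m]≡n s≤m) ⟩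
  (s + x) ⊓ m                 ∎
  where open ≡-Reasoning

⊓-telescope : ∀ s t m → sumBelow t (λ a → s ⊓ (m ∸ a * s)) ≡ (t * s) ⊓ m
⊓-telescope s zero    m = refl
⊓-telescope s (suc t) m = begin
  s ⊓ m + sumBelow t (λ a → s ⊓ (m ∸ (s + a * s)))
    ≡⟨ cong (s ⊓ m +_) (sumBelow-cong t (λ a _ → cong (s ⊓_) (≡.sym (ℕ.∸-+-assoc m s (a * s))))) ⟩
  s ⊓ m + sumBelow t (λ a → s ⊓ ((m ∸ s) ∸ a * s)) ≡⟨ cong (s ⊓ m +_) (⊓-telescope s t (m ∸ s)) ⟩
  s ⊓ m + (t * s) ⊓ (m ∸ s)                        ≡⟨ ⊓-telescope-step s m (t * s) ⟩
  (s + t * s) ⊓ m                                  ∎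
  where open ≡-Reasoning

edgeCount-gridGraph-+ : ∀ s m n′ → s ≤ n′ → m ≤ s * s → edgeCount (gridGraph s m (s + n′)) ≡ m
edgeCount-gridGraph-+ s m n′ s≤n′ m≤s² = begin
  edgeCount (gridGraph s m n)
    ≡⟨ edgeCount≡∑ (gridGraph s m n) ⟩
  ∑[ i < n ] ∑[ j < n ] boolToℕ ((toℕ i <ᵇ toℕ j) ∧ adj (gridGraph s m n) i j)
    ≡⟨ sum-cong-≗ {n} row ⟩
  ∑[ i < n ] sumBelow n (edge (toℕ i))
    ≡⟨ ∑-toℕ n (λ a → sumBelow n (edge a)) ⟩
  sumBelow (s + n′) (λ a → sumBelow n (edge a))
    ≡⟨ sumBelow-+ s n′ (λ a → sumBelow n (edge a)) ⟩
  sumBelow s (λ a → sumBelow n (edge a)) + sumBelow n′ (λ a′ → sumBelow n (edge (s + a′)))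
    ≡⟨ cong₂ _+_ (sumBelow-cong s (λ a a<s → gridRow s m n′ a s≤n′ a<s))
                 (sumBelow-zero n′ (λ a′ _ → sumBelow-zero n (λ b _ →
                   cong boolToℕ (dec-false (gridEdge? s m (s + a′) b) (λ e → ℕ.<⇒≱ (proj₁ e) (ℕ.m≤m+n s a′)))))) ⟩
  sumBelow s (λ a → s ⊓ (m ∸ a * s)) + 0
    ≡⟨ ℕ.+-identityʳ _ ⟩
  sumBelow s (λ a → s ⊓ (m ∸ a * s))
    ≡⟨ ⊓-telescope s s m ⟩
  (s * s) ⊓ m
    ≡⟨ ℕ.m≥n⇒m⊓n≡n m≤s² ⟩
  m ∎
  where
  open ≡-Reasoning
  n = s + n′
  edge : ℕ → ℕ → ℕ
  edge a b = boolToℕ (does (gridEdge? s m a b))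
  row : ∀ i → ∑[ j < n ] boolToℕ ((toℕ i <ᵇ toℕ j) ∧ adj (gridGraph s m n) i j) ≡ sumBelow n (edge (toℕ i))
  row i = trans (sum-cong-≗ {n} (λ j → cong boolToℕ (ordered-gridEdge s m (toℕ i) (toℕ j)))) (∑-toℕ n (edge (toℕ i)))

bernoulli : ∀ p n → p ^ suc n + suc n * p ^ n ≤ suc p ^ suc n
bernoulli p zero    = ℕ.≤-reflexive (identity p)
  where
  identity : ∀ p → p * 1 + 1 * 1 ≡ suc p * 1
  identity = solve-∀
bernoulli p (suc n) = begin
  p ^ suc (suc n) + suc (suc n) * p ^ suc n                  ≤⟨ ℕ.m≤m+n _ (suc n * p ^ n) ⟩
  p ^ suc (suc n) + suc (suc n) * p ^ suc n + suc n * p ^ n  ≡⟨ identity p n (p ^ n) ⟩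
  suc p * (p ^ suc n + suc n * p ^ n)                        ≤⟨ ℕ.*-monoʳ-≤ (suc p) (bernoulli p n) ⟩
  suc p ^ suc (suc n)                                        ∎
  where
  open ℕ.≤-Reasoning
  identity : ∀ p n x → p * (p * x) + suc (suc n) * (p * x) + suc n * x ≡ suc p * (p * x + suc n * x)
  identity = solve-∀

2*p^[1+p]≤[1+p]^[1+p] : ∀ p → 2 * p ^ suc p ≤ suc p ^ suc p
2*p^[1+p]≤[1+p]^[1+p] p = begin
  2 * p ^ suc p                ≡⟨ identity p (p ^ p) ⟩
  p ^ suc p + p * p ^ p        ≤⟨ ℕ.+-monoʳ-≤ (p ^ suc p) (ℕ.*-monoˡ-≤ (p ^ p) (ℕ.n≤1+n p)) ⟩
  p ^ suc p + suc p * p ^ p    ≤⟨ bernoulli p p ⟩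
  suc p ^ suc p                ∎
  where
  open ℕ.≤-Reasoning
  identity : ∀ p x → 2 * (p * x) ≡ p * x + p * x
  identity = solve-∀

^-distribʳ-* : ∀ a b e → (a * b) ^ e ≡ a ^ e * b ^ e
^-distribʳ-* a b zero    = refl
^-distribʳ-* a b (suc e) = trans (cong (a * b *_) (^-distribʳ-* a b e)) (interchange a b (a ^ e) (b ^ e))
  where
  interchange : ∀ a b x y → a * b * (x * y) ≡ a * x * (b * y)
  interchange = solve-∀

n<2^n : ∀ n → n < 2 ^ n
n<2^n zero    = s≤s z≤n
n<2^n (suc n) = ℕ.≤-trans (s≤s (n<2^n n)) (ℕ.≤-trans (ℕ.+-monoˡ-≤ (2 ^ n) (ℕ.m^n>0 2 n)) (ℕ.≤-reflexive (cong (2 ^ n +_) (≡.sym (ℕ.+-identityʳ (2 ^ n))))))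

-- (q / (q − 1)) ^ q ≥ 2 and 2 ^ q > q: hence the factor q · q in k.
q^2s*[q-1]^k<q^k : ∀ q s → 2 ≤ q → 1 ≤ s →
  let k = q * (q * (s + s)) in q ^ (s + s) * pred q ^ k < q ^ k
q^2s*[q-1]^k<q^k (suc p@(suc _)) s@(suc _) (s≤s (s≤s z≤n)) (s≤s z≤n) = begin-strict
  q ^ (s + s) * p ^ k                <⟨ ℕ.*-monoˡ-< (p ^ k) {{ℕ.m^n≢0 p k}} (ℕ.^-monoˡ-< (s + s) (n<2^n q)) ⟩
  (2 ^ q) ^ (s + s) * p ^ k           ≡⟨ cong₂ _*_ (ℕ.^-*-assoc 2 q (s + s)) (≡.sym (ℕ.^-*-assoc p q e)) ⟩
  2 ^ e * (p ^ q) ^ e                ≡⟨ ^-distribʳ-* 2 (p ^ q) e ⟨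
  (2 * p ^ q) ^ e                    ≤⟨ ℕ.^-monoˡ-≤ e (2*p^[1+p]≤[1+p]^[1+p] p) ⟩
  (q ^ q) ^ e                        ≡⟨ ℕ.^-*-assoc q q e ⟩
  q ^ k                              ∎
  where
  open ℕ.≤-Reasoning
  q = suc p
  e = q * (s + s)
  k = q * e

squareBetween : ∀ m → 1 ≤ m → ∃ λ s → 1 ≤ s × m ≤ s * s × s * s ≤ 4 * m
squareBetween (suc zero)    _ = 1 , ℕ.≤-refl , ℕ.≤-refl , s≤s z≤n
squareBetween (suc (suc m)) _ with squareBetween (suc m) (s≤s z≤n)
... | s , 1≤s , lo , hi with suc (suc m) ℕ.≤? s * s
...   | yes m+2≤s² = s , 1≤s , m+2≤s² , ℕ.≤-trans hi (ℕ.*-monoʳ-≤ 4 (ℕ.n≤1+n (suc m)))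
...   | no  m+2≰s² = suc s , s≤s z≤n , lo′ , hi′
  where
  open ℕ.≤-Reasoning
  s²≡m+1 : s * s ≡ suc m
  s²≡m+1 = ℕ.≤-antisym (ℕ.≤-pred (ℕ.≰⇒> m+2≰s²)) lo
  s≤m+1 : s ≤ suc m
  s≤m+1 = ℕ.≤-trans (ℕ.m≤m*n s s {{ℕ.>-nonZero 1≤s}}) (ℕ.≤-reflexive s²≡m+1)
  expand : ∀ s → suc (s * s) + (s + s) ≡ suc s * suc s
  expand = solve-∀
  lo′ : suc (suc m) ≤ suc s * suc s
  lo′ = begin
    suc (suc m)             ≡⟨ cong suc s²≡m+1 ⟨
    suc (s * s)             ≤⟨ ℕ.m≤m+n _ (s + s) ⟩
    suc (s * s) + (s + s)   ≡⟨ expand s ⟩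
    suc s * suc s           ∎
  bound : ∀ m → suc (suc m + (suc m + suc m)) ≤ 4 * suc (suc m)
  bound m = ℕ.≤-trans (ℕ.m≤m+n _ (m + 4)) (ℕ.≤-reflexive (identity m))
    where
    identity : ∀ m → suc (suc m + (suc m + suc m)) + (m + 4) ≡ 4 * suc (suc m)
    identity = solve-∀
  hi′ : suc s * suc s ≤ 4 * suc (suc m)
  hi′ = begin
    suc s * suc s                  ≡⟨ expand s ⟨
    suc (s * s) + (s + s)          ≤⟨ s≤s (ℕ.+-mono-≤ (ℕ.≤-reflexive s²≡m+1) (ℕ.+-mono-≤ s≤m+1 s≤m+1)) ⟩
    suc (suc m + (suc m + suc m))  ≤⟨ bound m ⟩
    4 * suc (suc m)                ∎

edgeCount-gridGraph : ∀ s m n → s + s ≤ n → m ≤ s * s → edgeCount (gridGraph s m n) ≡ m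
edgeCount-gridGraph s m n 2s≤n m≤s² =
  subst (λ t → edgeCount (gridGraph s m t) ≡ m) (ℕ.m+[n∸m]≡n (ℕ.≤-trans (ℕ.m≤m+n s s) 2s≤n))
        (edgeCount-gridGraph-+ s m (n ∸ s) (ℕ.m+n≤o⇒m≤o∸n s 2s≤n) m≤s²)

extendToSubset : ∀ {n} (b : Fin n → Bool) k → count b ≤ k → k ≤ n →
  Σ (Subset n) λ S → ∣ S ∣ ≡ k × (∀ i → b i ≡ true → i ∈ S)
extendToSubset {zero} b zero _ _ = [] , refl , λ ()
extendToSubset {suc n} b k c≤k k≤1+n with b Fin.zero in b₀
extendToSubset {suc n} b (suc k) c≤k k≤1+n | true =
  let S , ∣S∣≡k , b⊆S = extendToSubset (b ∘ Fin.suc) k (ℕ.≤-pred c≤k) (ℕ.≤-pred k≤1+n)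
  in inside ∷ S , cong suc ∣S∣≡k , λ { Fin.zero _ → here ; (Fin.suc i) bi → there (b⊆S i bi) }
... | false with k ℕ.≤? n
...   | yes k≤n =
  let S , ∣S∣≡k , b⊆S = extendToSubset (b ∘ Fin.suc) k c≤k k≤n
  in outside ∷ S , ∣S∣≡k , λ { Fin.zero b₀≡true → contradiction (trans (≡.sym b₀≡true) b₀) true≢false
                             ; (Fin.suc i) bi → there (b⊆S i bi) }
...   | no  k≰n = ⊤ , trans (∣⊤∣≡n (suc n)) (ℕ.≤-antisym (ℕ.≰⇒> k≰n) k≤1+n) , λ _ _ → ∈⊤

coverEdges : ∀ {n} (G : Graph n) k → nonIsolated G ≤ k → k ≤ n →
  Σ (Subset n) λ S → ∣ S ∣ ≡ k × ((i j : Fin n) → adj G i j ≡ true → (i ∈ S × j ∈ S))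
coverEdges G k ni≤k k≤n =
  let S , ∣S∣≡k , covers = extendToSubset (hasNeighbour G) k ni≤k k≤n
  in S , ∣S∣≡k , λ i j aij →
       covers i (Equivalence.from (hasNeighbour⇔ G i) (j , aij)) ,
       covers j (Equivalence.from (hasNeighbour⇔ G j) (i , trans (Graph.sym G j i) aij))

gridGraph-beats : ∀ q s m {n} (G : Graph n) → 2 ≤ q → 1 ≤ s → s + s ≤ n →
  2 * (q * (q * (s + s))) ≤ nonIsolated G → numColourings q G < numColourings q (gridGraph s m n)
gridGraph-beats q@(suc (suc _)) s m {n} G 2≤q@(s≤s (s≤s z≤n)) 1≤s 2s≤n 2k≤ni =
  ℕ.*-cancelˡ-< (q ^ (s + s) * q ^ k) _ _ (begin-strict
    q ^ (s + s) * q ^ k * numColourings q G        ≡⟨ reassoc (q ^ (s + s)) (q ^ k) (numColourings q G) ⟩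
    q ^ (s + s) * (numColourings q G * q ^ k)      ≤⟨ ℕ.*-monoʳ-≤ (q ^ (s + s)) (numColourings-nonIsolated q k G 2k≤ni) ⟩
    q ^ (s + s) * (q ^ n * pred q ^ k)             ≡⟨ reassoc′ (q ^ (s + s)) (q ^ n) (pred q ^ k) ⟩
    q ^ n * (q ^ (s + s) * pred q ^ k)             <⟨ ℕ.*-monoʳ-< (q ^ n) {{ℕ.m^n≢0 q n}} (q^2s*[q-1]^k<q^k q s 2≤q 1≤s) ⟩
    q ^ n * q ^ k                                  ≤⟨ ℕ.*-monoˡ-≤ (q ^ k) H-bound ⟩
    q ^ (s + s) * numColourings q H * q ^ k        ≡⟨ reassoc″ (q ^ (s + s)) (numColourings q H) (q ^ k) ⟩
    q ^ (s + s) * q ^ k * numColourings q H        ∎)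
  where
  open ℕ.≤-Reasoning
  k = q * (q * (s + s))
  H = gridGraph s m n
  H-bound : q ^ n ≤ q ^ (s + s) * numColourings q H
  H-bound = numColourings-splitBipartite Fin.zero (Fin.suc Fin.zero) s (λ ()) H (gridGraph-splitBipartite s m n)
  reassoc : ∀ a b c → a * b * c ≡ a * (c * b)
  reassoc = solve-∀
  reassoc′ : ∀ a b c → a * (b * c) ≡ b * (a * c)
  reassoc′ = solve-∀
  reassoc″ : ∀ a b c → a * b * c ≡ a * c * b
  reassoc″ = solve-∀

ℕtoℚ≡mkℚ : ∀ k → ℕtoℚ k ≡ mkℚ (ℤ.+ k) 0 (Coprime.sym (Coprime.1-coprimeTo k))
ℕtoℚ≡mkℚ k = ℚ.normalize-coprime (Coprime.sym (Coprime.1-coprimeTo k))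

ℕtoℚ-pos : ∀ k .{{_ : NonZero k}} → Positive (ℕtoℚ k)
ℕtoℚ-pos k = ℚ.normalize-pos k 1

ℕtoℚ-mono-≤ : ∀ {a b} → a ≤ b → ℕtoℚ a ≤ℚ ℕtoℚ b
ℕtoℚ-mono-≤ {a} {b} a≤b rewrite ℕtoℚ≡mkℚ a | ℕtoℚ≡mkℚ b =
  *≤* (subst₂ ℤ._≤_ (≡.sym (ℤ.*-identityʳ (ℤ.+ a))) (≡.sym (ℤ.*-identityʳ (ℤ.+ b))) (ℤ.+≤+ a≤b))

ℕtoℚ-homo-* : ∀ a b → ℕtoℚ (a * b) ≡ ℕtoℚ a *ℚ ℕtoℚ b
ℕtoℚ-homo-* a b rewrite ℕtoℚ≡mkℚ a | ℕtoℚ≡mkℚ b | ℕtoℚ≡mkℚ (a * b) =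
  ℚ.toℚᵘ-injective (ℚᵘ.≃-sym (ℚᵘ.≃-trans (ℚ.toℚᵘ-homo-* (mkℚ (ℤ.+ a) 0 (Coprime.sym (Coprime.1-coprimeTo a))) (mkℚ (ℤ.+ b) 0 (Coprime.sym (Coprime.1-coprimeTo b))))
                                         (ℚᵘ.*≡* (cong (ℤ._* ℤ.+ 1) (≡.sym (ℤ.pos-* a b))))))

ℕtoℚ-homo-*² : ∀ c m → ℕtoℚ (c * c * m) ≡ (ℕtoℚ c *ℚ ℕtoℚ c) *ℚ ℕtoℚ m
ℕtoℚ-homo-*² c m = trans (ℕtoℚ-homo-* (c * c) m) (cong (_*ℚ ℕtoℚ m) (ℕtoℚ-homo-* c c))

-- κ · ↧κ = ↥κ ≥ 1.
ℕtoℚ-≤-κ* : ∀ κ → Positive κ → ∀ {a b} → ↧ₙ κ * a ≤ b → ℕtoℚ a ≤ℚ κ *ℚ ℕtoℚ b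
ℕtoℚ-≤-κ* κ@(mkℚ ℤ.+[1+ p ] d-1 _) _ {a} {b} da≤b =
  ℚ.≤-trans (ℕtoℚ-≤-κ*↧κ a) (ℚ.*-monoˡ-≤-nonNeg κ {{ℚ.pos⇒nonNeg κ}} (ℕtoℚ-mono-≤ da≤b))
  where
  d = suc d-1
  ℕtoℚ-≤-κ*↧κ : ∀ a → ℕtoℚ a ≤ℚ κ *ℚ ℕtoℚ (d * a)
  ℕtoℚ-≤-κ*↧κ a rewrite ℕtoℚ≡mkℚ a | ℕtoℚ≡mkℚ (d * a) =
    ℚ.toℚᵘ-cancel-≤ (ℚᵘ.≤-respʳ-≃ (ℚᵘ.≃-sym (ℚ.toℚᵘ-homo-* κ (mkℚ (ℤ.+ (d * a)) 0 (Coprime.sym (Coprime.1-coprimeTo (d * a))))))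
      (ℚᵘ.*≤* (subst₂ ℤ._≤_ (ℤ.pos-* a (d * 1))
                             (trans (ℤ.pos-* (suc p * (d * a)) 1) (cong (ℤ._* ℤ.+ 1) (ℤ.pos-* (suc p) (d * a))))
                             (ℤ.+≤+ a*d≤[1+p]*[d*a]))))
    where
    a*d≤[1+p]*[d*a] : a * (d * 1) ≤ suc p * (d * a) * 1
    a*d≤[1+p]*[d*a] = begin
      a * (d * 1)          ≡⟨ cong (a *_) (ℕ.*-identityʳ d) ⟩
      a * d                ≡⟨ ℕ.*-comm a d ⟩
      d * a                ≤⟨ ℕ.m≤m+n (d * a) (p * (d * a)) ⟩
      suc p * (d * a)      ≡⟨ ℕ.*-identityʳ _ ⟨
      suc p * (d * a) * 1  ∎
      where open ℕ.≤-Reasoning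

scaledSquare-bounds : ∀ D s m → 1 ≤ D → m ≤ s * s → s * s ≤ 4 * m →
  1 * 1 * m ≤ D * s * (D * s) × D * s * (D * s) ≤ 2 * D * (2 * D) * m × D * m ≤ D * s * (D * s)
scaledSquare-bounds D s m 1≤D m≤s² s²≤4m =
  ℕ.≤-trans (ℕ.≤-reflexive (ℕ.*-identityˡ m)) (ℕ.≤-trans m≤s² (ℕ.*-mono-≤ s≤Ds s≤Ds)) ,
  ℕ.≤-trans (ℕ.≤-reflexive (square-* D s)) (ℕ.≤-trans (ℕ.*-monoʳ-≤ (D * D) s²≤4m) (ℕ.≤-reflexive (square-*-4 D m))) ,
  ℕ.≤-trans (ℕ.*-mono-≤ (ℕ.m≤m*n D D {{D≢0}}) m≤s²) (ℕ.≤-reflexive (≡.sym (square-* D s)))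
  where
  D≢0 = ℕ.>-nonZero 1≤D
  s≤Ds : s ≤ D * s
  s≤Ds = ℕ.m≤n*m s D {{D≢0}}
  square-* : ∀ D s → D * s * (D * s) ≡ D * D * (s * s)
  square-* = solve-∀
  square-*-4 : ∀ D m → D * D * (4 * m) ≡ 2 * D * (2 * D) * m
  square-*-4 = solve-∀

maximal⇒edgesCovered : ∀ q s m n₀ → 2 ≤ q → 1 ≤ s → m ≤ s * s → 2 * (q * (q * (s + s))) ≤ n₀ →
  (n : ℕ) → n₀ ≤ n → (G : Graph n) →
  ((H : Graph n) → edgeCount H ≡ m → numColourings q H ≤ numColourings q G) →
  Σ (Subset n) λ S → ∣ S ∣ ≡ n₀ × ((i j : Fin n) → adj G i j ≡ true → (i ∈ S × j ∈ S))
maximal⇒edgesCovered q@(suc (suc _)) s m n₀ 2≤q@(s≤s (s≤s z≤n)) 1≤s m≤s² 2k≤n₀ n n₀≤n G maximal with nonIsolated G ℕ.≤? n₀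
... | yes ni≤n₀ = coverEdges G n₀ ni≤n₀ n₀≤n
... | no  ni≰n₀ = contradiction (maximal (gridGraph s m n) (edgeCount-gridGraph s m n 2s≤n m≤s²))
                               (ℕ.<⇒≱ (gridGraph-beats q s m G 2≤q 1≤s 2s≤n 2k≤ni))
  where
  2k≤ni = ℕ.≤-trans 2k≤n₀ (ℕ.<⇒≤ (ℕ.≰⇒> ni≰n₀))
  2s≤n : s + s ≤ n
  2s≤n = ℕ.≤-trans (ℕ.m≤n*m (s + s) (2 * (q * q)))
           (ℕ.≤-trans (ℕ.≤-reflexive (reassoc q (s + s))) (ℕ.≤-trans 2k≤n₀ n₀≤n))
    where
    reassoc : ∀ q x → 2 * (q * q) * x ≡ 2 * (q * (q * x))
    reassoc = solve-∀

lemma3p4 : (q : ℕ) → 2 ≤ q → (κ : ℚ) → Positive κ →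
    Σ ℚ λ c₁ → Σ ℚ λ c₂ → Positive c₁ × Positive c₂ ×
    ((m : ℕ) → 1 ≤ m →
      Σ ℕ λ n₀ →
        ((c₁ *ℚ c₁) *ℚ ℕtoℚ m ≤ℚ ℕtoℚ (n₀ * n₀)) ×
        (ℕtoℚ (n₀ * n₀) ≤ℚ (c₂ *ℚ c₂) *ℚ ℕtoℚ m) ×
        (ℕtoℚ m ≤ℚ κ *ℚ ℕtoℚ (n₀ * n₀)) ×
        ((n : ℕ) → n₀ ≤ n → (G : Graph n) → edgeCount G ≡ m →
          ((H : Graph n) → edgeCount H ≡ m →
             numColourings q H ≤ numColourings q G) →
          Σ (Subset n) λ S → ∣ S ∣ ≡ n₀ ×
            ((i j : Fin n) → adj G i j ≡ true → (i ∈ S × j ∈ S))))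
lemma3p4 q@(suc (suc _)) 2≤q@(s≤s (s≤s z≤n)) κ κ>0 =
  ℕtoℚ 1 , ℕtoℚ (2 * D) , ℕtoℚ-pos 1 , ℕtoℚ-pos (2 * D) , λ m 1≤m →
  let s , 1≤s , m≤s² , s²≤4m = squareBetween m 1≤m
      lower , upper , dense  = scaledSquare-bounds D s m (s≤s z≤n) m≤s² s²≤4m
  in D * s ,
     subst (_≤ℚ ℕtoℚ (D * s * (D * s))) (ℕtoℚ-homo-*² 1 m) (ℕtoℚ-mono-≤ lower) ,
     subst (ℕtoℚ (D * s * (D * s)) ≤ℚ_) (ℕtoℚ-homo-*² (2 * D) m) (ℕtoℚ-mono-≤ upper) ,
     ℕtoℚ-≤-κ* κ κ>0 (ℕ.≤-trans (ℕ.*-monoˡ-≤ m ↧κ≤D) dense) ,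
     λ n n₀≤n G _ → maximal⇒edgesCovered q s m (D * s) 2≤q 1≤s m≤s² (2k≤Ds s) n n₀≤n G
  where
  D = 4 * q * q * ↧ₙ κ
  ↧κ≤D : ↧ₙ κ ≤ D
  ↧κ≤D = ℕ.m≤n*m (↧ₙ κ) (4 * q * q)
  2k≤Ds : ∀ s → 2 * (q * (q * (s + s))) ≤ D * s
  2k≤Ds s = ℕ.≤-trans (ℕ.≤-reflexive (reassoc q s)) (ℕ.*-monoˡ-≤ s (ℕ.m≤m*n (4 * q * q) (↧ₙ κ)))
    where
    reassoc : ∀ q s → 2 * (q * (q * (s + s))) ≡ 4 * q * q * s
    reassoc = solve-∀
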